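{- Let $G$ be a pertinent group, let $J$ be a subgroup of $G$ of order $2$, and let $H$ be a pertinent subgroup of $G$ containing $J$. If $\mathcal F_0$ is a $J$-resolvable $(H,\{2^3,3\},3,1)$ difference family and $\mathcal F$ is a $J$-resolvable $(G,H,3,1)$ difference family, then $\mathcal F\cup\mathcal F_0$ is a $J$-resolvable $(G,\{2^3,3\},3,1)$ difference family.
   Context: Groups are written additively (not necessarily abelian), $x-y:=x+(-y)$. A finite group is pertinent if it has exactly three involutions and they are pairwise conjugate. For a $3$-subset $B=\{x,y,z\}$, $\Delta B=\{\pm(x-y),\pm(x-z),\pm(y-z)\}$ (multiset); for a family $\mathcal F$ of $3$-subsets, $\Delta\mathcal F$ and $\Phi(\mathcal F)$ denote the multiset unions of the $\Delta B$ and of the blocks, respectively. For a subgroup $H$, a $(G,H,3,1)$ difference family is a family $\mathcal F$ of $3$-subsets with $\Delta\mathcal F=G\setminus H$ (each element once); for $J\le H$ of order $2$ it is $J$-resolvable if $\Phi(\mathcal F)$ is a complete system of representatives for the left cosets of $J$ in $G$ not contained in $H$. For a pertinent group $X$, an $(X,\{2^3,3\},3,1)$ difference family is a family $\mathcal F$ of $3$-subsets of $X$ with $\Delta\mathcal F$ equal (each element once) to the set of elements of $X$ lying in none of the members of a set $\Sigma$ consisting of three subgroups of order $2$ and one subgroup of order $3$ of $X$ with pairwise trivial intersections; for $J\le X$ of order $2$ it is $J$-resolvable if there exist $a,b\in X$ such that $J$, $a+J-a$, $b+J-b$ are the three subgroups of order $2$ of $X$ and $\Phi(\mathcal F)\cup\{0,a,b\}$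 is a complete system of representatives for the left cosets of $J$ in $X$. -}

module Defs where

open import Data.Nat using (ℕ)
open import Data.Fin using (Fin; _≟_)
open import Data.Fin.Properties using (any?)
open import Data.Fin.Subset using (Subset; _∈_; _∉_; _⊆_; ∣_∣; ⊤)
open import Data.Fin.Subset.Properties using (_∈?_)
open import Data.List using (List; []; _∷_; _++_; length; filter; concatMap)
open import Data.List.Membership.Propositional using () renaming (_∈_ to _∈ₗ_)
open import Data.Product using (Σ; ∃; ∃-syntax; _×_; _,_)
open import Data.Sum using (_⊎_)
open import Relation.Nullary using (¬_; Dec)
open import Relation.Nullary.Decidable using (_×-dec_)
open import Relation.Binary.PropositionalEquality using (_≡_; _≢_)
open import Algebra.Core using (Op₁; Op₂)
open import Algebra.Structures using (IsGroup)
open import Function.Bundles using (_⇔_)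

-- A finite group of order n, presented (up to isomorphism) on the carrier Fin n,
-- written additively (not necessarily abelian), with propositional equality.
record FinGroup : Set where
  infixl 6 _+_ _-_
  infix  8 -_
  field
    n       : ℕ
    _+_     : Op₂ (Fin n)
    0#      : Fin n
    -_      : Op₁ (Fin n)
    isGroup : IsGroup _≡_ _+_ 0# -_
  _-_ : Op₂ (Fin n)
  x - y = x + (- y)

module _ (G : FinGroup) where
  open FinGroup G

  -- subgroups are given as subsets (Vec Bool n); order = cardinality ∣ S ∣
  record IsSubgroup (S : Subset n) : Set where
    field
      0∈  : 0# ∈ S
      +∈  : ∀ {x y} → x ∈ S → y ∈ S → x + y ∈ S
      -∈  : ∀ {x} → x ∈ S → - x ∈ S

  IsInvolution : Fin n → Set
  IsInvolution x = (x ≢ 0#) × (x + x ≡ 0#)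

  Pertinent : Subset n → Set
  Pertinent X =
    (Σ (Fin n) λ t₁ → Σ (Fin n) λ t₂ → Σ (Fin n) λ t₃ →
       (t₁ ≢ t₂) × (t₁ ≢ t₃) × (t₂ ≢ t₃) ×
       (∀ x → ((x ∈ X) × IsInvolution x) ⇔ ((x ≡ t₁) ⊎ (x ≡ t₂) ⊎ (x ≡ t₃))))
    × (∀ s t → s ∈ X → IsInvolution s → t ∈ X → IsInvolution t →
         ∃[ h ] (h ∈ X) × (h + s - h ≡ t))

  record Block : Set where
    constructor ⟨_,_,_⟩[_,_,_]
    field
      x y z : Fin n
      x≢y : x ≢ y
      x≢z : x ≢ z
      y≢z : y ≢ z

  ΔB : Block → List (Fin n)
  ΔB B = (x - y) ∷ - (x - y) ∷ (x - z) ∷ - (x - z) ∷ (y - z) ∷ - (y - z) ∷ []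
    where open Block B

  ptsB : Block → List (Fin n)
  ptsB B = x ∷ y ∷ z ∷ [] where open Block B

  Δ : List Block → List (Fin n)
  Δ = concatMap ΔB

  Φ : List Block → List (Fin n)
  Φ = concatMap ptsB

  mult : Fin n → List (Fin n) → ℕ
  mult g L = length (filter (g ≟_) L)

  ExactlyOnce : (Fin n → Set) → List (Fin n) → Set
  ExactlyOnce P L = ∀ g → (P g → mult g L ≡ 1) × (¬ P g → mult g L ≡ 0)

  InLeftCoset : Fin n → Subset n → Fin n → Set
  InLeftCoset g J y = ∃[ j ] (j ∈ J) × (y ≡ g + j)

  inLeftCoset? : ∀ g J y → Dec (InLeftCoset g J y)
  inLeftCoset? g J y = any? (λ j → (j ∈? J) ×-dec (y ≟ g + j))

  multCoset : Fin n → Subset n → List (Fin n) → ℕ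
  multCoset g J L = length (filter (inLeftCoset? g J) L)

  -- L is a complete system of representatives for the left cosets g + J
  -- with Q g ("the coset g + J is one of the cosets under consideration");
  -- each element x of L lies in the coset x + J.
  CompleteReps : Subset n → (Fin n → Set) → List (Fin n) → Set
  CompleteReps J Q L = (∀ x → x ∈ₗ L → Q x) × (∀ g → Q g → multCoset g J L ≡ 1)

  LeftCosetContainedIn : Fin n → Subset n → Subset n → Set
  LeftCosetContainedIn g J H = ∀ j → j ∈ J → g + j ∈ H

  -- (G,H,3,1) difference family (G the whole group)
  RelDF : Subset n → List Block → Set
  RelDF H F = ExactlyOnce (λ g → g ∉ H) (Δ F)

  RelDFResolvable : Subset n → Subset n → List Block → Set
  RelDFResolvable H J F = RelDF H F ×
    CompleteReps J (λ g → ¬ LeftCosetContainedIn g J H) (Φ F)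

  -- (X,{2^3,3},3,1) difference family, for the group X (a subgroup of G,
  -- possibly G itself via X = ⊤); blocks are 3-subsets of X.
  BlocksIn : Subset n → List Block → Set
  BlocksIn X F = ∀ x → x ∈ₗ Φ F → x ∈ X

  SubgroupOfOrder : Subset n → ℕ → Subset n → Set
  SubgroupOfOrder X k S = IsSubgroup S × (S ⊆ X) × (∣ S ∣ ≡ k)

  TrivialIntersection : Subset n → Subset n → Set
  TrivialIntersection A B = ∀ y → y ∈ A → y ∈ B → y ≡ 0#

  DF23 : Subset n → List Block → Set
  DF23 X F = BlocksIn X F ×
    (Σ (Subset n) λ T₁ → Σ (Subset n) λ T₂ → Σ (Subset n) λ T₃ → Σ (Subset n) λ S →
      SubgroupOfOrder X 2 T₁ × SubgroupOfOrder X 2 T₂ × SubgroupOfOrder X 2 T₃ ×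
      SubgroupOfOrder X 3 S ×
      TrivialIntersection T₁ T₂ × TrivialIntersection T₁ T₃ × TrivialIntersection T₂ T₃ ×
      TrivialIntersection T₁ S × TrivialIntersection T₂ S × TrivialIntersection T₃ S ×
      ExactlyOnce (λ g → (g ∈ X) × (g ∉ T₁) × (g ∉ T₂) × (g ∉ T₃) × (g ∉ S)) (Δ F))

  InConj : Fin n → Subset n → Fin n → Set
  InConj a J y = ∃[ j ] (j ∈ J) × (y ≡ a + j - a)

  SameSet : (Fin n → Set) → (Fin n → Set) → Set
  SameSet P Q = ∀ y → P y ⇔ Q y

  DF23Resolvable : Subset n → Subset n → List Block → Set
  DF23Resolvable X J F = DF23 X F ×
    (Σ (Fin n) λ a → Σ (Fin n) λ b → (a ∈ X) × (b ∈ X) ×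
      ¬ SameSet (_∈ J) (InConj a J) × ¬ SameSet (_∈ J) (InConj b J) ×
      ¬ SameSet (InConj a J) (InConj b J) ×
      (∀ T → SubgroupOfOrder X 2 T →
         SameSet (_∈ T) (_∈ J) ⊎ SameSet (_∈ T) (InConj a J) ⊎ SameSet (_∈ T) (InConj b J)) ×
      CompleteReps J (λ g → g ∈ X) (Φ F ++ (0# ∷ a ∷ b ∷ [])))

{-# OPTIONS --safe #-}
-- The three involutions of H are involutions of G, so they are all the involutions of G;
-- hence every subgroup of order 2 of G lies in H, and the subgroups of Σ chosen for H
-- serve for G. The differences of F are exactly G ∖ H and those of F₀ exactly H minus Σ.
-- Since J ⊆ H, a left coset of J lies either inside or outside H: the cosets inside are
-- represented by Φ F₀ ∪ {0, a, b}, the cosets outside by Φ F.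
module Submission where

open import Defs
open import Algebra.Bundles using (Group)
open import Algebra.Structures using (IsGroup)
import Algebra.Properties.Group as GroupProperties
open import Data.Empty using (⊥; ⊥-elim)
open import Data.Fin using (Fin; _≟_)
open import Data.Fin.Subset using (Subset; ∣_∣; _⊆_; ⊤; _∈_; _∉_)
import Data.Fin.Subset as Subset
open import Data.Fin.Subset.Properties using (_∈?_; ∈⊤; x∈p∧x≢y⇒x∈p-y; x∈p⇒∣p-x∣<∣p∣)
open import Data.List using (List; _++_; length; filter)
open import Data.List.Properties using (filter-++; length-++; filter-none; concatMap-++; ++-assoc)
open import Data.List.Relation.Unary.All using (tabulate)
open import Data.List.Membership.Propositional using () renaming (_∈_ to _∈ₗ_)
open import Data.List.Membership.Propositional.Properties using (∈-++⁻)
open import Data.Nat using (_≤_; z≤n; s≤s) renaming (_+_ to _+ℕ_)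
open import Data.Nat.Properties using (<-irrefl; module ≤-Reasoning)
open import Data.Product using (_×_; _,_; proj₁; proj₂)
open import Data.Sum using (_⊎_; inj₁; inj₂; swap)
open import Function.Base using (_∘_)
open import Function.Bundles using (_⇔_; mk⇔; Equivalence)
open import Function.Related.TypeIsomorphisms using (¬-cong-⇔)
open import Level using (0ℓ)
open import Relation.Binary.Definitions using (DecidableEquality)
open import Relation.Binary.PropositionalEquality
  using (_≡_; _≢_; refl; sym; trans; cong; cong₂; subst; module ≡-Reasoning)
open import Relation.Nullary using (¬_; yes; no)
open import Relation.Nullary.Decidable using (toSum)
open import Relation.Unary using (Pred; Decidable)

open Equivalence using (to; from)

module _ {A : Set} {P : Pred A 0ℓ} (P? : Decidable P) where

  length-filter-++ : ∀ xs ys →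
    length (filter P? (xs ++ ys)) ≡ length (filter P? xs) +ℕ length (filter P? ys)
  length-filter-++ xs ys = trans (cong length (filter-++ P? xs ys)) (length-++ (filter P? xs))

  length-filter-none : ∀ {xs} → (∀ {x} → x ∈ₗ xs → ¬ P x) → length (filter P? xs) ≡ 0
  length-filter-none none = cong length (filter-none P? (tabulate none))

module _ {A : Set} where

  OneOf₃ : A → A → A → A → Set
  OneOf₃ x a b c = x ≡ a ⊎ x ≡ b ⊎ x ≡ c

  private
    rotate : ∀ {x a b c : A} → OneOf₃ x a b c → OneOf₃ x b c a
    rotate (inj₁ x≡a)        = inj₂ (inj₂ x≡a)
    rotate (inj₂ (inj₁ x≡b)) = inj₁ x≡b
    rotate (inj₂ (inj₂ x≡c)) = inj₂ (inj₁ x≡c)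

    avoid-third : ∀ {x s a b c : A} → OneOf₃ s a b c → x ≡ c → x ≢ s → s ≡ a ⊎ s ≡ b
    avoid-third (inj₁ s≡a)        _   _   = inj₁ s≡a
    avoid-third (inj₂ (inj₁ s≡b)) _   _   = inj₂ s≡b
    avoid-third (inj₂ (inj₂ s≡c)) x≡c x≢s = ⊥-elim (x≢s (trans x≡c (sym s≡c)))

    pigeonhole₂ : ∀ {s₁ s₂ s₃ a b : A} → s₁ ≡ a ⊎ s₁ ≡ b → s₂ ≡ a ⊎ s₂ ≡ b → s₃ ≡ a ⊎ s₃ ≡ b →
      s₁ ≢ s₂ → s₁ ≢ s₃ → s₂ ≢ s₃ → ⊥
    pigeonhole₂ (inj₁ e₁) (inj₁ e₂) _         d₁₂ _   _   = d₁₂ (trans e₁ (sym e₂))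
    pigeonhole₂ (inj₂ e₁) (inj₂ e₂) _         d₁₂ _   _   = d₁₂ (trans e₁ (sym e₂))
    pigeonhole₂ (inj₁ e₁) _         (inj₁ e₃) _   d₁₃ _   = d₁₃ (trans e₁ (sym e₃))
    pigeonhole₂ (inj₂ e₁) _         (inj₂ e₃) _   d₁₃ _   = d₁₃ (trans e₁ (sym e₃))
    pigeonhole₂ _         (inj₁ e₂) (inj₁ e₃) _   _   d₂₃ = d₂₃ (trans e₂ (sym e₃))
    pigeonhole₂ _         (inj₂ e₂) (inj₂ e₃) _   _   d₂₃ = d₂₃ (trans e₂ (sym e₃))

  OneOf₃-exhausted : DecidableEquality A → ∀ {x s₁ s₂ s₃ t₁ t₂ t₃ : A} →
    OneOf₃ s₁ t₁ t₂ t₃ → OneOf₃ s₂ t₁ t₂ t₃ → OneOf₃ s₃ t₁ t₂ t₃ →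
    s₁ ≢ s₂ → s₁ ≢ s₃ → s₂ ≢ s₃ →
    OneOf₃ x t₁ t₂ t₃ → OneOf₃ x s₁ s₂ s₃
  OneOf₃-exhausted _≟ᴬ_ {x} {s₁} {s₂} {s₃} {t₁} {t₂} {t₃} h₁ h₂ h₃ d₁₂ d₁₃ d₂₃ hx
    with x ≟ᴬ s₁ | x ≟ᴬ s₂ | x ≟ᴬ s₃
  ... | yes x≡s₁ | _        | _        = inj₁ x≡s₁
  ... | no _     | yes x≡s₂ | _        = inj₂ (inj₁ x≡s₂)
  ... | no _     | no _     | yes x≡s₃ = inj₂ (inj₂ x≡s₃)
  ... | no x≢s₁  | no x≢s₂  | no x≢s₃  = ⊥-elim (without hx)
    where
    without : OneOf₃ x t₁ t₂ t₃ → ⊥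
    without (inj₂ (inj₂ x≡t₃)) = pigeonhole₂
      (avoid-third h₁ x≡t₃ x≢s₁) (avoid-third h₂ x≡t₃ x≢s₂) (avoid-third h₃ x≡t₃ x≢s₃) d₁₂ d₁₃ d₂₃
    without (inj₁ x≡t₁) = pigeonhole₂
      (avoid-third (rotate h₁) x≡t₁ x≢s₁) (avoid-third (rotate h₂) x≡t₁ x≢s₂)
      (avoid-third (rotate h₃) x≡t₁ x≢s₃) d₁₂ d₁₃ d₂₃
    without (inj₂ (inj₁ x≡t₂)) = pigeonhole₂
      (avoid-third (rotate (rotate h₁)) x≡t₂ x≢s₁) (avoid-third (rotate (rotate h₂)) x≡t₂ x≢s₂)
      (avoid-third (rotate (rotate h₃)) x≡t₂ x≢s₃) d₁₂ d₁₃ d₂₃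

distinct-triple⇒3≤∣p∣ : ∀ {n} {p : Subset n} {i j k : Fin n} →
  i ∈ p → j ∈ p → k ∈ p → i ≢ j → i ≢ k → j ≢ k → 3 ≤ ∣ p ∣
distinct-triple⇒3≤∣p∣ {p = p} {i} {j} {k} i∈p j∈p k∈p i≢j i≢k j≢k = begin
  3                                           ≤⟨ s≤s (s≤s (s≤s z≤n)) ⟩
  3 +ℕ ∣ p Subset.- i Subset.- j Subset.- k ∣ ≤⟨ s≤s (s≤s (x∈p⇒∣p-x∣<∣p∣ k∈p-i-j)) ⟩
  2 +ℕ ∣ p Subset.- i Subset.- j ∣            ≤⟨ s≤s (x∈p⇒∣p-x∣<∣p∣ j∈p-i) ⟩
  1 +ℕ ∣ p Subset.- i ∣                       ≤⟨ x∈p⇒∣p-x∣<∣p∣ i∈p ⟩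
  ∣ p ∣                                       ∎
  where
  open ≤-Reasoning
  j∈p-i : j ∈ p Subset.- i
  j∈p-i = x∈p∧x≢y⇒x∈p-y j∈p (i≢j ∘ sym)
  k∈p-i-j : k ∈ p Subset.- i Subset.- j
  k∈p-i-j = x∈p∧x≢y⇒x∈p-y (x∈p∧x≢y⇒x∈p-y k∈p (i≢k ∘ sym)) (j≢k ∘ sym)

module _ (G : FinGroup) where
  open FinGroup G

  private
    group : Group 0ℓ 0ℓ
    group = record { isGroup = isGroup }

  open GroupProperties group using (identityʳ-unique; //-rightDividesʳ)

  order-2-subgroup-member : ∀ {T x} → IsSubgroup G T → ∣ T ∣ ≡ 2 → x ∈ T →
    x ≡ 0# ⊎ IsInvolution G x
  order-2-subgroup-member {x = x} sT ∣T∣≡2 x∈T with x ≟ 0# | x + x ≟ 0#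
  ... | yes x≡0 | _          = inj₁ x≡0
  ... | no x≢0  | yes x+x≡0  = inj₂ (x≢0 , x+x≡0)
  ... | no x≢0  | no x+x≢0   = ⊥-elim (<-irrefl refl (subst (3 ≤_) ∣T∣≡2
        (distinct-triple⇒3≤∣p∣ 0∈ x∈T (+∈ x∈T x∈T) (x≢0 ∘ sym) (x+x≢0 ∘ sym) x≢x+x)))
    where
    open IsSubgroup sT
    x≢x+x : x ≢ x + x
    x≢x+x = x≢0 ∘ identityʳ-unique x x ∘ sym

  order-2-subgroup-⊆ : ∀ {H T} → IsSubgroup G H → (∀ {x} → IsInvolution G x → x ∈ H) →
    IsSubgroup G T → ∣ T ∣ ≡ 2 → T ⊆ H
  order-2-subgroup-⊆ sH involution∈H sT ∣T∣≡2 x∈T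
    with order-2-subgroup-member sT ∣T∣≡2 x∈T
  ... | inj₁ refl          = IsSubgroup.0∈ sH
  ... | inj₂ x-involution  = involution∈H x-involution

  involution∈pertinent-subgroup : ∀ {H x} → Pertinent G ⊤ → Pertinent G H →
    IsInvolution G x → x ∈ H
  involution∈pertinent-subgroup {x = x}
    ((t₁ , t₂ , t₃ , _ , _ , _ , involutionsG) , _)
    ((s₁ , s₂ , s₃ , s₁≢s₂ , s₁≢s₃ , s₂≢s₃ , involutionsH) , _) x-involution =
    proj₁ (from (involutionsH x) (OneOf₃-exhausted _≟_
      (sᵢ-involution (inj₁ refl)) (sᵢ-involution (inj₂ (inj₁ refl)))
      (sᵢ-involution (inj₂ (inj₂ refl)))
      s₁≢s₂ s₁≢s₃ s₂≢s₃ (to (involutionsG x) (∈⊤ , x-involution))))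
    where
    sᵢ-involution : ∀ {s} → OneOf₃ s s₁ s₂ s₃ → OneOf₃ s t₁ t₂ t₃
    sᵢ-involution {s} s=sᵢ = to (involutionsG s) (∈⊤ , proj₂ (from (involutionsH s) s=sᵢ))

  ∈-coset⇔ : ∀ {J H g x} → IsSubgroup G H → J ⊆ H → InLeftCoset G g J x → g ∈ H ⇔ x ∈ H
  ∈-coset⇔ {H = H} {g} sH J⊆H (j , j∈J , refl) = mk⇔
    (λ g∈H → +∈ g∈H (J⊆H j∈J))
    (λ g+j∈H → subst (_∈ H) (//-rightDividesʳ j g) (+∈ g+j∈H (-∈ (J⊆H j∈J))))
    where open IsSubgroup sH

  LeftCosetContainedIn⇔∈ : ∀ {J H g} → IsSubgroup G J → IsSubgroup G H → J ⊆ H →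
    LeftCosetContainedIn G g J H ⇔ g ∈ H
  LeftCosetContainedIn⇔∈ {H = H} {g} sJ sH J⊆H = mk⇔
    (λ g+J⊆H → subst (_∈ H) (identityʳ g) (g+J⊆H 0# (IsSubgroup.0∈ sJ)))
    (λ g∈H j j∈J → IsSubgroup.+∈ sH g∈H (J⊆H j∈J))
    where open IsGroup isGroup using (identityʳ)

  ExactlyOnce-cong : ∀ {P Q : Fin n → Set} {L} → (∀ g → P g ⇔ Q g) →
    ExactlyOnce G P L → ExactlyOnce G Q L
  ExactlyOnce-cong P⇔Q onceP g =
    proj₁ (onceP g) ∘ from (P⇔Q g) , proj₂ (onceP g) ∘ (_∘ to (P⇔Q g))

  ExactlyOnce-⊎ : ∀ {P Q : Fin n → Set} {L M} → (∀ {g} → P g → ¬ Q g) →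
    ExactlyOnce G P L → ExactlyOnce G Q M → ExactlyOnce G (λ g → P g ⊎ Q g) (L ++ M)
  ExactlyOnce-⊎ {P} {Q} {L} {M} disjoint onceP onceQ g = counted , uncounted
    where
    mult-++ : mult G g (L ++ M) ≡ mult G g L +ℕ mult G g M
    mult-++ = length-filter-++ (g ≟_) L M
    counted : P g ⊎ Q g → mult G g (L ++ M) ≡ 1
    counted (inj₁ p) = trans mult-++
      (cong₂ _+ℕ_ (proj₁ (onceP g) p) (proj₂ (onceQ g) (disjoint p)))
    counted (inj₂ q) = trans mult-++
      (cong₂ _+ℕ_ (proj₂ (onceP g) (λ p → disjoint p q)) (proj₁ (onceQ g) q))
    uncounted : ¬ (P g ⊎ Q g) → mult G g (L ++ M) ≡ 0
    uncounted ¬p⊎q = trans mult-++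
      (cong₂ _+ℕ_ (proj₂ (onceP g) (¬p⊎q ∘ inj₁)) (proj₂ (onceQ g) (¬p⊎q ∘ inj₂)))

  CompleteReps-cong : ∀ {J} {P Q : Fin n → Set} {L} → (∀ g → P g ⇔ Q g) →
    CompleteReps G J P L → CompleteReps G J Q L
  CompleteReps-cong P⇔Q (L⊆P , countP) =
    (λ x x∈L → to (P⇔Q x) (L⊆P x x∈L)) , (λ g q → countP g (from (P⇔Q g) q))

  CompleteReps-⊎ : ∀ {J} {P Q : Fin n → Set} {L M} →
    (∀ {g x} → InLeftCoset G g J x → P g → ¬ Q x) →
    (∀ {g x} → InLeftCoset G g J x → Q g → ¬ P x) →
    CompleteReps G J P L → CompleteReps G J Q M →
    CompleteReps G J (λ g → P g ⊎ Q g) (L ++ M)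
  CompleteReps-⊎ {J} {P} {Q} {L} {M} P-avoids-Q Q-avoids-P (L⊆P , countP) (M⊆Q , countQ) =
    members , counts
    where
    members : ∀ x → x ∈ₗ L ++ M → P x ⊎ Q x
    members x x∈L++M with ∈-++⁻ L x∈L++M
    ... | inj₁ x∈L = inj₁ (L⊆P x x∈L)
    ... | inj₂ x∈M = inj₂ (M⊆Q x x∈M)
    multCoset-++ : ∀ g → multCoset G g J (L ++ M) ≡ multCoset G g J L +ℕ multCoset G g J M
    multCoset-++ g = length-filter-++ (inLeftCoset? G g J) L M
    counts : ∀ g → P g ⊎ Q g → multCoset G g J (L ++ M) ≡ 1
    counts g (inj₁ p) = trans (multCoset-++ g) (cong₂ _+ℕ_ (countP g p)
      (length-filter-none (inLeftCoset? G g J) (λ x∈M x∈g+J → P-avoids-Q x∈g+J p (M⊆Q _ x∈M))))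
    counts g (inj₂ q) = trans (multCoset-++ g) (cong₂ _+ℕ_
      (length-filter-none (inLeftCoset? G g J) (λ x∈L x∈g+J → Q-avoids-P x∈g+J q (L⊆P _ x∈L)))
      (countQ g q))

  order-2-subgroup-within : ∀ {H T} → IsSubgroup G H → (∀ {x} → IsInvolution G x → x ∈ H) →
    SubgroupOfOrder G ⊤ 2 T → SubgroupOfOrder G H 2 T
  order-2-subgroup-within sH involution∈H (sT , _ , ∣T∣≡2) =
    sT , order-2-subgroup-⊆ sH involution∈H sT ∣T∣≡2 , ∣T∣≡2

  DF23-++ : ∀ {H F F₀} → RelDF G H F → DF23 G H F₀ → DF23 G ⊤ (F ++ F₀)
  DF23-++ {H} {F} {F₀} onceF
    (_ , T₁ , T₂ , T₃ , S , o₁ , o₂ , o₃ , oS , d₁₂ , d₁₃ , d₂₃ , d₁S , d₂S , d₃S , onceF₀) =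
    (λ _ _ → ∈⊤) , T₁ , T₂ , T₃ , S , widen o₁ , widen o₂ , widen o₃ , widen oS ,
    d₁₂ , d₁₃ , d₂₃ , d₁S , d₂S , d₃S ,
    subst (ExactlyOnce G (λ g → g ∈ ⊤ × Avoids g)) (sym (concatMap-++ (ΔB G) F F₀))
      (ExactlyOnce-cong {L = Δ G F ++ Δ G F₀} split
        (ExactlyOnce-⊎ {L = Δ G F} {Δ G F₀} (λ g∉H (g∈H , _) → g∉H g∈H) onceF onceF₀))
    where
    Avoids : Fin n → Set
    Avoids g = g ∉ T₁ × g ∉ T₂ × g ∉ T₃ × g ∉ S
    widen : ∀ {k T} → SubgroupOfOrder G H k T → SubgroupOfOrder G ⊤ k T
    widen (sT , _ , ∣T∣≡k) = sT , (λ _ → ∈⊤) , ∣T∣≡k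
    outside : ∀ {k T g} → SubgroupOfOrder G H k T → g ∉ H → g ∉ T
    outside (_ , T⊆H , _) g∉H g∈T = g∉H (T⊆H g∈T)
    split : ∀ g → (g ∉ H ⊎ (g ∈ H × Avoids g)) ⇔ (g ∈ ⊤ × Avoids g)
    split g = mk⇔ forward backward
      where
      forward : g ∉ H ⊎ (g ∈ H × Avoids g) → g ∈ ⊤ × Avoids g
      forward (inj₁ g∉H)          =
        ∈⊤ , outside o₁ g∉H , outside o₂ g∉H , outside o₃ g∉H , outside oS g∉H
      forward (inj₂ (_ , avoids)) = ∈⊤ , avoids
      backward : g ∈ ⊤ × Avoids g → g ∉ H ⊎ (g ∈ H × Avoids g)
      backward (_ , avoids) with g ∈? H
      ... | yes g∈H = inj₂ (g∈H , avoids)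
      ... | no g∉H  = inj₁ g∉H

  CompleteReps-++ : ∀ {J H L M} → IsSubgroup G J → IsSubgroup G H → J ⊆ H →
    CompleteReps G J (λ g → ¬ LeftCosetContainedIn G g J H) L →
    CompleteReps G J (_∈ H) M →
    CompleteReps G J (_∈ ⊤) (L ++ M)
  CompleteReps-++ {H = H} sJ sH J⊆H repsL repsM =
    CompleteReps-cong everything (CompleteReps-⊎
      (λ x∈g+J g∉H x∈H → g∉H (from (∈-coset⇔ sH J⊆H x∈g+J) x∈H))
      (λ x∈g+J g∈H x∉H → x∉H (to (∈-coset⇔ sH J⊆H x∈g+J) g∈H))
      (CompleteReps-cong (λ _ → ¬-cong-⇔ (LeftCosetContainedIn⇔∈ sJ sH J⊆H)) repsL)
      repsM)
    where
    everything : ∀ g → (g ∉ H ⊎ g ∈ H) ⇔ g ∈ ⊤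
    everything g = mk⇔ (λ _ → ∈⊤) (λ _ → swap (toSum (g ∈? H)))

  Φ-++ : ∀ F F₀ R → Φ G F ++ (Φ G F₀ ++ R) ≡ Φ G (F ++ F₀) ++ R
  Φ-++ F F₀ R = begin
    Φ G F ++ (Φ G F₀ ++ R)  ≡⟨ ++-assoc (Φ G F) (Φ G F₀) R ⟨
    (Φ G F ++ Φ G F₀) ++ R  ≡⟨ cong (_++ R) (concatMap-++ (ptsB G) F F₀) ⟨
    Φ G (F ++ F₀) ++ R      ∎
    where open ≡-Reasoning

proposition3p7 : (G : FinGroup) (J H : Subset (FinGroup.n G)) →
    Pertinent G ⊤ →
    IsSubgroup G J → ∣ J ∣ ≡ 2 →
    IsSubgroup G H → Pertinent G H → J ⊆ H →
    (F₀ F : List (Block G)) →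
    DF23Resolvable G H J F₀ →
    RelDFResolvable G H J F →
    DF23Resolvable G ⊤ J (F ++ F₀)
proposition3p7 G J H pertinentG sJ _ sH pertinentH J⊆H F₀ F
  (onceF₀ , a , b , _ , _ , J≉a+J-a , J≉b+J-b , a+J-a≉b+J-b , order-2-in-H , repsF₀)
  (onceF , repsF) =
  DF23-++ G {F = F} {F₀} onceF onceF₀ ,
  a , b , ∈⊤ , ∈⊤ , J≉a+J-a , J≉b+J-b , a+J-a≉b+J-b ,
  (λ T → order-2-in-H T ∘ order-2-subgroup-within G sH involution∈H) ,
  subst (CompleteReps G J (_∈ ⊤)) (Φ-++ G F F₀ _) (CompleteReps-++ G sJ sH J⊆H repsF repsF₀)
  where
  involution∈H : ∀ {x} → IsInvolution G x → x ∈ H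
  involution∈H = involution∈pertinent-subgroup G pertinentG pertinentH
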